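{- Let $n\geq 3$ and let $G$ be a graph with $n$ vertices that is a disjoint union of vertex-disjoint cycles, each of odd length (number of edges). Then $G$ is $\left\lceil \frac{2n}{3}\right\rceil$-approximately magic.
   Context: For a graph with $m$ edges, a labeling is a bijection $f$ from the edge set to $\{1,\ldots,m\}$; the vertex sum at a vertex $v$ is the sum of $f(e)$ over all edges $e$ incident with $v$. A labeling is $\delta$-approximately magic if the difference between the largest and the smallest vertex sums is at most $\delta$. A graph is $\delta$-approximately magic if it admits a $\delta$-approximately magic labeling. $\lceil x\rceil$ denotes the least integer not less than $x$. -}

module Defs where

open import Data.Nat using (ℕ; zero; suc; _+_; _*_; _≤_; _/_; _%_)
open import Data.Nat.DivMod using (m%n<n)

open import Data.Fin using (Fin; toℕ; fromℕ<; _≟_)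
open import Data.List using (List; map; allFin)
open import Data.Nat.ListAction using (sum)
open import Data.Product using (Σ; _×_; _,_; proj₁; proj₂)
open import Data.Sum using (_⊎_)
open import Function.Bundles using (_⤖_; Bijection)
open import Relation.Binary.PropositionalEquality using (_≡_)
open import Relation.Nullary using (yes; no)

Odd : ℕ → Set
Odd n = Σ ℕ (λ t → n ≡ 2 * t + 1)

record Graph (n m : ℕ) : Set where
  field
    ends : Fin m → Fin n × Fin n
open Graph public

_≈ₚ_ : ∀ {n} → Fin n × Fin n → Fin n × Fin n → Set
(a , b) ≈ₚ (x , y) = ((a ≡ x) × (b ≡ y)) ⊎ ((a ≡ y) × (b ≡ x))

next : ∀ {ℓ} → Fin ℓ → Fin ℓ
next {suc l} j = fromℕ< (m%n<n (suc (toℕ j)) (suc l))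

-- G is a disjoint union of vertex-disjoint cycles, all of odd length:
-- there are k cycles with lengths len i (≥ 3, odd), a bijection φ between
-- "cycle positions" (i , j) and the vertices, and a bijection ψ between the
-- edges of G and the positions, such that the edge ψ⁻¹(i , j) joins
-- φ (i , j) and φ (i , j+1 mod len i).
record OddCycleUnion {n m : ℕ} (G : Graph n m) : Set where
  field
    k       : ℕ
    len     : Fin k → ℕ
    len≥3   : ∀ i → 3 ≤ len i
    lenOdd  : ∀ i → Odd (len i)
    φ       : Σ (Fin k) (λ i → Fin (len i)) ⤖ Fin n
    ψ       : Fin m ⤖ Σ (Fin k) (λ i → Fin (len i))
    edges   : ∀ e →
      let ij = Bijection.to ψ e in
      ends G e ≈ₚ ( Bijection.to φ ij
                  , Bijection.to φ (proj₁ ij , next (proj₂ ij)) )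

-- A labeling: a bijection from the edges to {1,…,m}, encoded as a bijection
-- Fin m ⤖ Fin m, edge e getting label 1 + toℕ (f e).
Labeling : ℕ → Set
Labeling m = Fin m ⤖ Fin m

label : ∀ {m} → Labeling m → Fin m → ℕ
label f e = suc (toℕ (Bijection.to f e))

contrib : ∀ {n m} → Graph n m → Labeling m → Fin n → Fin m → ℕ
contrib G f v e with proj₁ (ends G e) ≟ v | proj₂ (ends G e) ≟ v
... | yes _ | _     = label f e
... | no _  | yes _ = label f e
... | no _  | no _  = 0

vertexSum : ∀ {n m} → Graph n m → Labeling m → Fin n → ℕ
vertexSum G f v = sum (map (contrib G f v) (allFin _))

-- δ-approximately magic labeling: max vertex sum − min vertex sum ≤ δ.
ApproxMagicLabeling : ∀ {n m} → Graph n m → ℕ → Labeling m → Set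
ApproxMagicLabeling G δ f = ∀ u v → vertexSum G f u ≤ vertexSum G f v + δ

ApproxMagic : ∀ {n m} → Graph n m → ℕ → Set
ApproxMagic {m = m} G δ = Σ (Labeling m) (ApproxMagicLabeling G δ)

-- ⌈ 2n / 3 ⌉ = ⌊ (2n + 2) / 3 ⌋
ceil2n/3 : ℕ → ℕ
ceil2n/3 n = (2 * n + 2) / 3

module Submission where

-- Let the cycles have lengths 2tᵢ + 1 and put B = Σ tᵢ. The p-th edge of cycle i gets the
-- height (B − tᵢ) + z(p), where z = 0, 2tᵢ − 1, 2, 2tᵢ − 3, …, 1, 2tᵢ is a permutation of
-- {0, …, 2tᵢ} whose cyclically consecutive entries sum to 2tᵢ − 1, 2tᵢ + 1 or 2tᵢ; so the two
-- edges at any vertex have heights summing to 2B − 1, 2B or 2B + 1. Label the edges 1, …, m in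
-- order of height, breaking ties by cycle index (in reverse order at odd heights). The label of
-- an edge is the sum over the cycles c of the number of edges of c not after it. At a vertex of
-- cycle i, the two edges together receive between 2t_c and 2t_c + 2 from every cycle c ≠ i,
-- thanks to the alternating tie-break, and between 2tᵢ + 1 and 2tᵢ + 3 from cycle i. Hence all
-- vertex sums lie in a window of width 2k, and 3k ≤ n gives 2k ≤ ⌈2n/3⌉.

open import Algebra.Properties.CommutativeSemigroup using (interchange)
open import Data.Bool using (Bool; true; false; not; _xor_; if_then_else_)
open import Data.Bool.Properties using (not-distribˡ-xor; xor-same)
open import Data.Fin as Fin using (Fin; zero; suc; toℕ; opposite; punchOut)
import Data.Fin.Properties as Fin
open import Data.List using (map; allFin; tabulate)
open import Data.List.Properties using (map-tabulate)
open import Data.Nat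
open import Data.Nat.DivMod using (m<n⇒m%n≡m; %-congˡ; n%n≡0; m*n/n≡m; /-monoˡ-≤)
import Data.Nat.ListAction as List
open import Data.Nat.Properties
open import Data.Nat.Tactic.RingSolver using (solve-∀)
open import Data.Product using (Σ; ∃; _×_; _,_; proj₁; proj₂)
open import Data.Product.Properties using (Σ-≡,≡←≡; ,-injective)
open import Data.Sum using (_⊎_; inj₁; inj₂; [_,_]′)
open import Function using (_∘_)
open import Function.Bundles using (Bijection; Inverse; mk⤖)
open import Function.Consequences.Propositional using (strictlySurjective⇒surjective)
open import Function.Definitions using (Injective)
open import Function.Properties.Bijection using (⤖⇒↔)
open import Relation.Binary.Definitions using (tri<; tri≈; tri>)
open import Relation.Binary.PropositionalEquality
open import Relation.Nullary using (Dec; yes; no; ¬_; contradiction)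

open import Defs

open import Algebra.Properties.CommutativeMonoid.Sum +-0-commutativeMonoid
  using (sum; sum-syntax; sum-cong-≗; ∑-distrib-+)

∑-mono-≤ : ∀ {k} {f g : Fin k → ℕ} → (∀ i → f i ≤ g i) → sum f ≤ sum g
∑-mono-≤ {zero}  f≤g = z≤n
∑-mono-≤ {suc k} f≤g = +-mono-≤ (f≤g zero) (∑-mono-≤ (f≤g ∘ suc))

∑-mono-< : ∀ {k} {f g : Fin k → ℕ} → (∀ i → f i ≤ g i) → ∀ a → f a < g a → sum f < sum g
∑-mono-< f≤g zero    fa<ga = +-mono-<-≤ fa<ga (∑-mono-≤ (f≤g ∘ suc))
∑-mono-< f≤g (suc a) fa<ga = +-mono-≤-< (f≤g zero) (∑-mono-< (f≤g ∘ suc) a fa<ga)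

∑-const : ∀ k c → ∑[ i < k ] c ≡ k * c
∑-const zero    c = refl
∑-const (suc k) c = cong (c +_) (∑-const k c)

term≤∑ : ∀ {k} (f : Fin k → ℕ) a → f a ≤ sum f
term≤∑ f zero    = m≤m+n (f zero) _
term≤∑ f (suc a) = ≤-trans (term≤∑ (f ∘ suc) a) (m≤n+m _ (f zero))

∑-support₁ : ∀ {k} {f : Fin k → ℕ} a → (∀ i → i ≢ a → f i ≡ 0) → sum f ≡ f a
∑-support₁ {suc k} {f} zero f₀ = begin
  f zero + ∑[ i < k ] f (suc i) ≡⟨ cong (f zero +_) (sum-cong-≗ (λ i → f₀ (suc i) λ ())) ⟩
  f zero + ∑[ i < k ] 0         ≡⟨ cong (f zero +_) (trans (∑-const k 0) (*-zeroʳ k)) ⟩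
  f zero + 0                    ≡⟨ +-identityʳ (f zero) ⟩
  f zero                        ∎
  where open ≡-Reasoning
∑-support₁ {suc k} {f} (suc a) f₀ =
  cong₂ _+_ (f₀ zero λ ()) (∑-support₁ a (λ i i≢a → f₀ (suc i) (i≢a ∘ Fin.suc-injective)))

∑-support₂ : ∀ {k} {f : Fin k → ℕ} a b → a ≢ b → (∀ i → i ≢ a → i ≢ b → f i ≡ 0) →
             sum f ≡ f a + f b
∑-support₂ zero zero a≢b f₀ = contradiction refl a≢b
∑-support₂ {f = f} zero (suc b) a≢b f₀ =
  cong (f zero +_) (∑-support₁ b (λ i i≢b → f₀ (suc i) (λ ()) (i≢b ∘ Fin.suc-injective)))
∑-support₂ {f = f} (suc a) zero a≢b f₀ = trans
  (cong (f zero +_) (∑-support₁ a (λ i i≢a → f₀ (suc i) (i≢a ∘ Fin.suc-injective) (λ ()))))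
  (+-comm (f zero) _)
∑-support₂ (suc a) (suc b) a≢b f₀ = cong₂ _+_ (f₀ zero (λ ()) (λ ()))
  (∑-support₂ a b (a≢b ∘ cong suc)
    (λ i i≢a i≢b → f₀ (suc i) (i≢a ∘ Fin.suc-injective) (i≢b ∘ Fin.suc-injective)))

sum-tabulate : ∀ {k} (f : Fin k → ℕ) → List.sum (tabulate f) ≡ sum f
sum-tabulate {zero}  f = refl
sum-tabulate {suc k} f = cong (f zero +_) (sum-tabulate (f ∘ suc))

sum-map-allFin : ∀ {k} (f : Fin k → ℕ) → List.sum (map f (allFin k)) ≡ sum f
sum-map-allFin f = trans (cong List.sum (map-tabulate (λ i → i) f)) (sum-tabulate f)

bit : {A : Set} → Dec A → ℕ
bit (yes _) = 1
bit (no _)  = 0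

bit≤1 : {A : Set} (a? : Dec A) → bit a? ≤ 1
bit≤1 (yes _) = ≤-refl
bit≤1 (no _)  = z≤n

bit-yes : {A : Set} → A → (a? : Dec A) → bit a? ≡ 1
bit-yes a (yes _) = refl
bit-yes a (no ¬a) = contradiction a ¬a

bit-no : {A : Set} → ¬ A → (a? : Dec A) → bit a? ≡ 0
bit-no ¬a (yes a) = contradiction a ¬a
bit-no ¬a (no _)  = refl

bit-mono : {A B : Set} → (A → B) → (a? : Dec A) (b? : Dec B) → bit a? ≤ bit b?
bit-mono A→B (yes a) b? = ≤-reflexive (sym (bit-yes (A→B a) b?))
bit-mono A→B (no _)  b? = z≤n

∑-indicator : ∀ {k} (i : Fin k) → ∑[ c < k ] bit (c Fin.≟ i) ≡ 1
∑-indicator i = trans (∑-support₁ i (λ c c≢i → bit-no c≢i _)) (bit-yes refl _)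

odd : ℕ → Bool
odd zero    = false
odd (suc n) = not (odd n)

odd-+ : ∀ m n → odd (m + n) ≡ odd m xor odd n
odd-+ zero    n = refl
odd-+ (suc m) n = trans (cong not (odd-+ m n)) (not-distribˡ-xor (odd m) (odd n))

odd-2* : ∀ n → odd (2 * n) ≡ false
odd-2* n = trans (cong (λ m → odd (n + m)) (+-identityʳ n)) (trans (odd-+ n n) (xor-same (odd n)))

even+odd≢2* : ∀ {P Q} t → odd P ≡ false → odd Q ≡ true → P + Q ≢ 2 * t
even+odd≢2* {P} {Q} t oP oQ P+Q≡2t
  with () ← trans (sym (odd-2* t)) (trans (cong odd (sym P+Q≡2t)) (trans (odd-+ P Q) (cong₂ _xor_ oP oQ)))

odd-sum⇒parities-differ : ∀ m n → odd (m + n) ≡ true → odd m ≢ odd n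
odd-sum⇒parities-differ m n odd[m+n] same
  with () ← trans (sym (xor-same (odd n))) (trans (cong (_xor odd n) (sym same)) (trans (sym (odd-+ m n)) odd[m+n]))

injective⇒surjective : ∀ {m} {f : Fin m → Fin m} → Injective _≡_ _≡_ f → ∀ y → ∃ λ x → f x ≡ y
injective⇒surjective {suc m} {f} f-inj y with Fin.any? (λ x → f x Fin.≟ y)
... | yes hit  = hit
... | no  miss = contradiction (Fin.injective⇒≤ g-inj) (n≮n m)
  where
  g : Fin (suc m) → Fin m
  g x = punchOut {i = y} (λ y≡fx → miss (x , sym y≡fx))
  g-inj : Injective _≡_ _≡_ g
  g-inj = f-inj ∘ Fin.punchOut-injective {i = y} _ _

opposite-injective : ∀ {k} → Injective _≡_ _≡_ (opposite {k})
opposite-injective {x = i} {y = j} eq =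
  trans (sym (Fin.opposite-involutive i)) (trans (cong opposite eq) (Fin.opposite-involutive j))

opposite-< : ∀ {k} {i j : Fin k} → i Fin.< j → opposite j Fin.< opposite i
opposite-< {i = i} {j} i<j = subst₂ _<_ (sym (Fin.opposite-prop j)) (sym (Fin.opposite-prop i))
  (∸-monoʳ-< (s≤s i<j) (Fin.toℕ<n j))

≤-vs-opposite : ∀ {k} {c i : Fin k} → c ≢ i → bit (c Fin.≤? i) + bit (opposite c Fin.≤? opposite i) ≡ 1
≤-vs-opposite {c = c} {i} c≢i with Fin.<-cmp c i
... | tri< c<i _ _ = cong₂ _+_ (bit-yes (<⇒≤ c<i) (c Fin.≤? i))
                               (bit-no (<⇒≱ (opposite-< c<i)) (opposite c Fin.≤? opposite i))
... | tri≈ _ c≡i _ = contradiction c≡i c≢i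
... | tri> _ _ i<c = cong₂ _+_ (bit-no (<⇒≱ i<c) (c Fin.≤? i))
                               (bit-yes (<⇒≤ (opposite-< i<c)) (opposite c Fin.≤? opposite i))

toΣ : ∀ {k} (len : Fin k → ℕ) → Fin (sum len) → Σ (Fin k) (Fin ∘ len)
toΣ {suc k} len x with Fin.splitAt (len zero) x
... | inj₁ j = zero , j
... | inj₂ r = let (i , j) = toΣ (len ∘ suc) r in suc i , j

fromΣ : ∀ {k} (len : Fin k → ℕ) → Σ (Fin k) (Fin ∘ len) → Fin (sum len)
fromΣ {suc k} len (zero  , j) = j Fin.↑ˡ _
fromΣ {suc k} len (suc i , j) = len zero Fin.↑ʳ fromΣ (len ∘ suc) (i , j)

fromΣ-toΣ : ∀ {k} (len : Fin k → ℕ) x → fromΣ len (toΣ len x) ≡ x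
fromΣ-toΣ {suc k} len x with Fin.splitAt (len zero) x in split
... | inj₁ j = Fin.splitAt⁻¹-↑ˡ split
... | inj₂ r = trans (cong (len zero Fin.↑ʳ_) (fromΣ-toΣ (len ∘ suc) r)) (Fin.splitAt⁻¹-↑ʳ split)

injective⇒∑≤ : ∀ {k m} {len : Fin k → ℕ} {f : Σ (Fin k) (Fin ∘ len) → Fin m} →
               Injective _≡_ _≡_ f → sum len ≤ m
injective⇒∑≤ {len = len} f-inj = Fin.injective⇒≤ λ {x} {y} eq →
  trans (sym (fromΣ-toΣ len x)) (trans (cong (fromΣ len) (f-inj eq)) (fromΣ-toΣ len y))

CyclicSucc : ℕ → ℕ → ℕ → Set
CyclicSucc ℓ P Q = (suc P < ℓ × Q ≡ suc P) ⊎ (suc P ≡ ℓ × Q ≡ 0)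

toℕ-next : ∀ {ℓ} (j : Fin ℓ) → CyclicSucc ℓ (toℕ j) (toℕ (next j))
toℕ-next {suc ℓ} j with m≤n⇒m<n∨m≡n (Fin.toℕ<n j)
... | inj₁ 1+j<ℓ = inj₁ (1+j<ℓ , trans (Fin.toℕ-fromℕ< _) (m<n⇒m%n≡m 1+j<ℓ))
... | inj₂ 1+j≡ℓ = inj₂ (1+j≡ℓ ,
  trans (Fin.toℕ-fromℕ< _) (trans (%-congˡ {o = suc ℓ} 1+j≡ℓ) (n%n≡0 (suc ℓ))))

next-injective : ∀ {ℓ} → Injective _≡_ _≡_ (next {ℓ})
next-injective {x = i} {y = j} eq with toℕ-next i | toℕ-next j
... | inj₁ (_ , i⁺) | inj₁ (_ , j⁺) =
  Fin.toℕ-injective (suc-injective (trans (sym i⁺) (trans (cong toℕ eq) j⁺)))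
... | inj₂ (i≡ , _) | inj₂ (j≡ , _) = Fin.toℕ-injective (suc-injective (trans i≡ (sym j≡)))
... | inj₁ (_ , i⁺) | inj₂ (_ , j⁰) with () ← trans (sym i⁺) (trans (cong toℕ eq) j⁰)
... | inj₂ (_ , i⁰) | inj₁ (_ , j⁺) with () ← trans (sym j⁺) (trans (cong toℕ (sym eq)) i⁰)

next-surjective : ∀ {ℓ} (j : Fin ℓ) → ∃ λ i → next i ≡ j
next-surjective = injective⇒surjective next-injective

next≢ : ∀ {ℓ} → 2 ≤ ℓ → (j : Fin ℓ) → next j ≢ j
next≢ 2≤ℓ j eq with toℕ-next j
... | inj₁ (_ , j⁺) = 1+n≢n (trans (sym j⁺) (cong toℕ eq))
... | inj₂ (1+j≡ℓ , j⁰) =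
  <-irrefl refl (subst (2 ≤_) (trans (sym 1+j≡ℓ) (cong suc (trans (sym (cong toℕ eq)) j⁰))) 2≤ℓ)

-- Counting in a window

-- clamp b L x is the number of elements of {b, …, b + L − 1} below x.
clamp : ℕ → ℕ → ℕ → ℕ
clamp b L x = (x ∸ b) ⊓ L

clamp-mono : ∀ b L {x y} → x ≤ y → clamp b L x ≤ clamp b L y
clamp-mono b L x≤y = ⊓-monoˡ-≤ L (∸-monoˡ-≤ b x≤y)

clamp≤ : ∀ b L x → clamp b L x ≤ L
clamp≤ b L x = m⊓n≤n (x ∸ b) L

clamp-pos : ∀ b L {x} → b < x → 0 < L → 0 < clamp b L x
clamp-pos b L b<x 0<L = ⊓-glb (m<n⇒0<n∸m b<x) 0<L

clamp-< : ∀ b L {x y} → x < y → b < y → y ≤ b + L → clamp b L x < clamp b L y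
clamp-< b L {x} {y} x<y b<y y≤b+L = begin-strict
  clamp b L x ≤⟨ m⊓n≤m (x ∸ b) L ⟩
  x ∸ b       <⟨ x∸b<y∸b ⟩
  y ∸ b       ≡⟨ m≤n⇒m⊓n≡m (m≤n+o⇒m∸n≤o y b y≤b+L) ⟨
  clamp b L y ∎
  where
  open ≤-Reasoning
  x∸b<y∸b : x ∸ b < y ∸ b
  x∸b<y∸b with b ≤? x
  ... | yes b≤x = ∸-monoˡ-< x<y b≤x
  ... | no  b≰x = subst (_< y ∸ b) (sym (m≤n⇒m∸n≡0 (<⇒≤ (≰⇒> b≰x)))) (m<n⇒0<n∸m b<y)

⊓-subadditive : ∀ m n o → (m + n) ⊓ o ≤ m ⊓ o + n ⊓ o
⊓-subadditive m n o with m ≤? o | n ≤? o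
... | yes m≤o | yes n≤o = begin
  (m + n) ⊓ o   ≤⟨ m⊓n≤m (m + n) o ⟩
  m + n         ≡⟨ cong₂ _+_ (m≤n⇒m⊓n≡m m≤o) (m≤n⇒m⊓n≡m n≤o) ⟨
  m ⊓ o + n ⊓ o ∎
  where open ≤-Reasoning
... | no m≰o | _ = begin
  (m + n) ⊓ o   ≤⟨ m⊓n≤n (m + n) o ⟩
  o             ≡⟨ m≥n⇒m⊓n≡n (<⇒≤ (≰⇒> m≰o)) ⟨
  m ⊓ o         ≤⟨ m≤m+n (m ⊓ o) (n ⊓ o) ⟩
  m ⊓ o + n ⊓ o ∎
  where open ≤-Reasoning
... | _ | no n≰o = begin
  (m + n) ⊓ o   ≤⟨ m⊓n≤n (m + n) o ⟩
  o             ≡⟨ m≥n⇒m⊓n≡n (<⇒≤ (≰⇒> n≰o)) ⟨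
  n ⊓ o         ≤⟨ m≤n+m (n ⊓ o) (m ⊓ o) ⟩
  m ⊓ o + n ⊓ o ∎
  where open ≤-Reasoning

+-double-interchange : ∀ b x y → (b + x) + (b + y) ≡ 2 * b + (x + y)
+-double-interchange = solve-∀

clamp-pair : ∀ b L {x y s} → x + y ≡ 2 * b + s →
             s ⊓ L ≤ clamp b L x + clamp b L y × clamp b L x + clamp b L y ≤ s ⊔ L
clamp-pair b L {x} {y} {s} x+y≡ = lower , upper
  where
  open ≤-Reasoning
  lower : s ⊓ L ≤ clamp b L x + clamp b L y
  lower = begin
    s ⊓ L                       ≤⟨ ⊓-monoˡ-≤ L (+-cancelˡ-≤ (2 * b) s _ (begin
      2 * b + s                     ≡⟨ x+y≡ ⟨
      x + y                         ≤⟨ +-mono-≤ (m≤n+m∸n x b) (m≤n+m∸n y b) ⟩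
      (b + (x ∸ b)) + (b + (y ∸ b)) ≡⟨ +-double-interchange b (x ∸ b) (y ∸ b) ⟩
      2 * b + ((x ∸ b) + (y ∸ b))   ∎)) ⟩
    ((x ∸ b) + (y ∸ b)) ⊓ L     ≤⟨ ⊓-subadditive (x ∸ b) (y ∸ b) L ⟩
    clamp b L x + clamp b L y   ∎
  below⇒0 : ∀ {z} → ¬ b ≤ z → clamp b L z ≡ 0
  below⇒0 b≰z = cong (_⊓ L) (m≤n⇒m∸n≡0 (<⇒≤ (≰⇒> b≰z)))
  upper : clamp b L x + clamp b L y ≤ s ⊔ L
  upper with b ≤? x | b ≤? y
  ... | yes b≤x | yes b≤y = begin
    clamp b L x + clamp b L y ≤⟨ +-mono-≤ (m⊓n≤m (x ∸ b) L) (m⊓n≤m (y ∸ b) L) ⟩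
    (x ∸ b) + (y ∸ b)         ≡⟨ +-cancelˡ-≡ (2 * b) _ _ (begin-equality
      2 * b + ((x ∸ b) + (y ∸ b))   ≡⟨ +-double-interchange b (x ∸ b) (y ∸ b) ⟨
      (b + (x ∸ b)) + (b + (y ∸ b)) ≡⟨ cong₂ _+_ (m+[n∸m]≡n b≤x) (m+[n∸m]≡n b≤y) ⟩
      x + y                         ≡⟨ x+y≡ ⟩
      2 * b + s                     ∎) ⟩
    s                         ≤⟨ m≤m⊔n s L ⟩
    s ⊔ L                     ∎
  ... | no b≰x | _ = begin
    clamp b L x + clamp b L y ≡⟨ cong (_+ clamp b L y) (below⇒0 b≰x) ⟩
    clamp b L y               ≤⟨ clamp≤ b L y ⟩
    L                         ≤⟨ m≤n⊔m s L ⟩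
    s ⊔ L                     ∎
  ... | _ | no b≰y = begin
    clamp b L x + clamp b L y ≡⟨ cong (clamp b L x +_) (below⇒0 b≰y) ⟩
    clamp b L x + 0           ≡⟨ +-identityʳ _ ⟩
    clamp b L x               ≤⟨ clamp≤ b L x ⟩
    L                         ≤⟨ m≤n⊔m s L ⟩
    s ⊔ L                     ∎

window-pair : ∀ b t {x y σ δ} → x + y ≡ 2 * b + (2 * t + σ) → δ ≤ 1 → δ ≤ σ → σ ≤ 2 + δ →
              2 * t + δ ≤ clamp b (2 * t + 1) x + clamp b (2 * t + 1) y ×
              clamp b (2 * t + 1) x + clamp b (2 * t + 1) y ≤ 2 * t + (2 + δ)
window-pair b t {x} {y} {σ} {δ} x+y≡ δ≤1 δ≤σ σ≤2+δ = lower , upper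
  where
  open ≤-Reasoning
  bounds = clamp-pair b (2 * t + 1) x+y≡
  lower : 2 * t + δ ≤ clamp b (2 * t + 1) x + clamp b (2 * t + 1) y
  lower = begin
    2 * t + δ                  ≤⟨ +-monoʳ-≤ (2 * t) (⊓-glb δ≤σ δ≤1) ⟩
    2 * t + (σ ⊓ 1)            ≡⟨ +-distribˡ-⊓ (2 * t) σ 1 ⟩
    (2 * t + σ) ⊓ (2 * t + 1)  ≤⟨ proj₁ bounds ⟩
    clamp b (2 * t + 1) x + clamp b (2 * t + 1) y ∎
  upper : clamp b (2 * t + 1) x + clamp b (2 * t + 1) y ≤ 2 * t + (2 + δ)
  upper = begin
    clamp b (2 * t + 1) x + clamp b (2 * t + 1) y ≤⟨ proj₂ bounds ⟩
    (2 * t + σ) ⊔ (2 * t + 1)  ≡⟨ +-distribˡ-⊔ (2 * t) σ 1 ⟨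
    2 * t + (σ ⊔ 1)            ≤⟨ +-monoʳ-≤ (2 * t) (⊔-lub σ≤2+δ (s≤s z≤n)) ⟩
    2 * t + (2 + δ)            ∎

-- The zigzag permutation

zigzag : ℕ → ℕ → ℕ
zigzag t P = if odd P then 2 * t ∸ P else P

zigzag-even : ∀ t {P} → odd P ≡ false → zigzag t P ≡ P
zigzag-even t even rewrite even = refl

zigzag≤ : ∀ t {P} → P ≤ 2 * t → zigzag t P ≤ 2 * t
zigzag≤ t {P} P≤2t with odd P
... | true  = m∸n≤m (2 * t) P
... | false = P≤2t

zigzag-injective : ∀ t {P Q} → P ≤ 2 * t → Q ≤ 2 * t → zigzag t P ≡ zigzag t Q → P ≡ Q
zigzag-injective t {P} {Q} P≤2t Q≤2t eq with odd P in oP | odd Q in oQ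
... | false | false = eq
... | true  | true  = ∸-cancelˡ-≡ P≤2t Q≤2t eq
... | false | true  = contradiction (trans (cong (_+ Q) eq) (m∸n+n≡m Q≤2t)) (even+odd≢2* {P} t oP oQ)
... | true  | false = contradiction (trans (cong (_+ P) (sym eq)) (m∸n+n≡m P≤2t)) (even+odd≢2* {Q} t oQ oP)

data NearDouble (s B : ℕ) : Set where
  exact : s ≡ 2 * B     → NearDouble s B
  short : s + 1 ≡ 2 * B → NearDouble s B
  over  : s ≡ 2 * B + 1 → NearDouble s B

NearDouble-shift : ∀ {s B} b → NearDouble s B → NearDouble (2 * b + s) (b + B)
NearDouble-shift {s} {B} b (exact s≡) = exact (trans (cong (2 * b +_) s≡) (sym (*-distribˡ-+ 2 b B)))
NearDouble-shift {s} {B} b (short s≡) = short (trans (+-assoc (2 * b) s 1)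
  (trans (cong (2 * b +_) s≡) (sym (*-distribˡ-+ 2 b B))))
NearDouble-shift {s} {B} b (over s≡) = over (trans (cong (2 * b +_) s≡)
  (trans (sym (+-assoc (2 * b) (2 * B) 1)) (cong (_+ 1) (sym (*-distribˡ-+ 2 b B)))))

odd-if-short : ∀ {s B} → s + 1 ≡ 2 * B → odd s ≡ true
odd-if-short {s} {B} s+1≡ with odd s | trans (cong odd (trans (+-comm 1 s) s+1≡)) (odd-2* B)
... | true  | _  = refl
... | false | ()

odd-if-over : ∀ {s B} → s ≡ 2 * B + 1 → odd s ≡ true
odd-if-over {s} {B} s≡ = trans (cong odd s≡) (trans (odd-+ (2 * B) 1) (cong (_xor true) (odd-2* B)))

zigzag-near : ∀ t {P Q} → CyclicSucc (2 * t + 1) P Q → NearDouble (zigzag t P + zigzag t Q) t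
zigzag-near t {P} (inj₁ (1+P<ℓ , refl)) with odd P
... | false = short (begin
  P + (2 * t ∸ suc P) + 1 ≡⟨ +-comm (P + (2 * t ∸ suc P)) 1 ⟩
  suc P + (2 * t ∸ suc P) ≡⟨ m+[n∸m]≡n 1+P≤2t ⟩
  2 * t                   ∎)
  where
  open ≡-Reasoning
  1+P≤2t : suc P ≤ 2 * t
  1+P≤2t = s≤s⁻¹ (subst (suc (suc P) ≤_) (+-comm (2 * t) 1) 1+P<ℓ)
... | true = over (begin
  2 * t ∸ P + suc P   ≡⟨ +-suc (2 * t ∸ P) P ⟩
  suc (2 * t ∸ P + P) ≡⟨ cong suc (m∸n+n≡m P≤2t) ⟩
  suc (2 * t)         ≡⟨ +-comm 1 (2 * t) ⟩
  2 * t + 1           ∎)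
  where
  open ≡-Reasoning
  P≤2t : P ≤ 2 * t
  P≤2t = s≤s⁻¹ (≤-trans (n≤1+n _) (subst (suc (suc P) ≤_) (+-comm (2 * t) 1) 1+P<ℓ))
zigzag-near t {P} (inj₂ (1+P≡ℓ , refl)) = exact (begin
  zigzag t P + 0   ≡⟨ +-identityʳ (zigzag t P) ⟩
  zigzag t P       ≡⟨ cong (zigzag t) P≡2t ⟩
  zigzag t (2 * t) ≡⟨ zigzag-even t (odd-2* t) ⟩
  2 * t            ∎)
  where
  open ≡-Reasoning
  P≡2t : P ≡ 2 * t
  P≡2t = suc-injective (trans 1+P≡ℓ (+-comm (2 * t) 1))

-- The rank labeling

-- Cycle i is the column i, with edges (i , P) for P ≤ 2 t i. The edges are ordered by _≺_ and
-- lab i P is the rank of (i , P); the heights of column c fill the window of length 2 t c + 1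
-- at base c, so the number count c i P of edges of column c not after (i , P) is a clamp.
module RankLabeling {k : ℕ} (t : Fin k → ℕ) where

  B : ℕ
  B = sum t

  base : Fin k → ℕ
  base c = B ∸ t c

  base+t : ∀ c → base c + t c ≡ B
  base+t c = m∸n+n≡m (term≤∑ t c)

  height : Fin k → ℕ → ℕ
  height i P = base i + zigzag (t i) P

  -- Reversing the column order at odd heights makes two edges of opposite parity resolve a tie
  -- with a third column in opposite ways (tie-flip).
  orient : Bool → Fin k → Fin k
  orient false i = i
  orient true  i = opposite i

  slot : ℕ → Fin k → Fin k
  slot h = orient (odd h)

  tie : ℕ → Fin k → Fin k → ℕ
  tie h c i = bit (slot h c Fin.≤? slot h i)

  key : Fin k → Fin k → ℕ → ℕ
  key c i P = height i P + tie (height i P) c i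

  count : Fin k → Fin k → ℕ → ℕ
  count c i P = clamp (base c) (2 * t c + 1) (key c i P)

  lab : Fin k → ℕ → ℕ
  lab i P = ∑[ c < k ] count c i P

  data _≺_ : Fin k × ℕ → Fin k × ℕ → Set where
    by-height : ∀ {i P j Q} → height i P < height j Q → (i , P) ≺ (j , Q)
    by-slot   : ∀ {i P j Q} → height i P ≡ height j Q → slot (height i P) i Fin.< slot (height i P) j →
                (i , P) ≺ (j , Q)

  orient-injective : ∀ b → Injective _≡_ _≡_ (orient b)
  orient-injective false = λ i≡j → i≡j
  orient-injective true  = opposite-injective

  height-injective : ∀ i {P Q} → P ≤ 2 * t i → Q ≤ 2 * t i → height i P ≡ height i Q → P ≡ Q
  height-injective i P≤2t Q≤2t eq = zigzag-injective (t i) P≤2t Q≤2t (+-cancelˡ-≡ (base i) _ _ eq)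

  tie≤1 : ∀ h c i → tie h c i ≤ 1
  tie≤1 h c i = bit≤1 _

  tie-self : ∀ h i → tie h i i ≡ 1
  tie-self h i = bit-yes Fin.≤-refl _

  key≤1+height : ∀ c i P → key c i P ≤ suc (height i P)
  key≤1+height c i P =
    ≤-trans (+-monoʳ-≤ (height i P) (tie≤1 (height i P) c i)) (≤-reflexive (+-comm (height i P) 1))

  key-self : ∀ i P → key i i P ≡ suc (height i P)
  key-self i P = trans (cong (height i P +_) (tie-self (height i P) i)) (+-comm (height i P) 1)

  key-self-in-window : ∀ i {P} → P ≤ 2 * t i → base i < key i i P × key i i P ≤ base i + (2 * t i + 1)
  key-self-in-window i {P} P≤2t rewrite key-self i P =
    s≤s (m≤m+n (base i) _) ,
    ≤-trans (≤-reflexive (sym (+-suc (base i) _)))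
            (+-monoʳ-≤ (base i)
              (subst (suc (zigzag (t i) P) ≤_) (+-comm 1 (2 * t i)) (s≤s (zigzag≤ (t i) P≤2t))))

  key-mono : ∀ {i P j Q} → (i , P) ≺ (j , Q) → ∀ c → key c i P ≤ key c j Q
  key-mono {i} {P} {j} {Q} (by-height h<h′) c =
    ≤-trans (key≤1+height c i P) (≤-trans h<h′ (m≤m+n (height j Q) _))
  key-mono {i} {P} {j} {Q} (by-slot h≡h′ i<j) c = +-mono-≤ (≤-reflexive h≡h′)
    (subst (λ h′ → tie (height i P) c i ≤ tie h′ c j) h≡h′
      (bit-mono (λ c≤i → ≤-trans c≤i (<⇒≤ i<j)) _ _))

  key-strict : ∀ {i P j Q} → (i , P) ≺ (j , Q) → key j i P < key j j Q
  key-strict {i} {P} {j} {Q} (by-height h<h′) =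
    subst (key j i P <_) (sym (key-self j Q)) (s≤s (≤-trans (key≤1+height j i P) h<h′))
  key-strict {i} {P} {j} {Q} (by-slot h≡h′ i<j) =
    subst₂ _<_ (sym key≡height) (sym (key-self j Q)) (s≤s (≤-reflexive h≡h′))
    where
    key≡height : key j i P ≡ height i P
    key≡height = trans (cong (height i P +_) (bit-no (<⇒≱ i<j) _)) (+-identityʳ (height i P))

  lab-< : ∀ {i P j Q} → Q ≤ 2 * t j → (i , P) ≺ (j , Q) → lab i P < lab j Q
  lab-< {i} {P} {j} {Q} Q≤2t i≺j with key-self-in-window j Q≤2t
  ... | base<key , key≤top = ∑-mono-< (λ c → clamp-mono (base c) (2 * t c + 1) (key-mono i≺j c)) j
        (clamp-< (base j) (2 * t j + 1) (key-strict i≺j) base<key key≤top)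

  ≺-trichotomy : ∀ i j {P Q} → P ≤ 2 * t i → Q ≤ 2 * t j →
                 (i , P) ≺ (j , Q) ⊎ (i , P) ≡ (j , Q) ⊎ (j , Q) ≺ (i , P)
  ≺-trichotomy i j {P} {Q} P≤2t Q≤2t with <-cmp (height i P) (height j Q)
  ... | tri< h<h′ _ _ = inj₁ (by-height h<h′)
  ... | tri> _ _ h′<h = inj₂ (inj₂ (by-height h′<h))
  ... | tri≈ _ h≡h′ _ with Fin.<-cmp (slot (height i P) i) (slot (height i P) j)
  ...   | tri< i<j _ _ = inj₁ (by-slot h≡h′ i<j)
  ...   | tri> _ _ j<i = inj₂ (inj₂ (by-slot (sym h≡h′) (subst (λ h → slot h j Fin.< slot h i) h≡h′ j<i)))
  ...   | tri≈ _ i≡j _ with orient-injective (odd (height i P)) i≡j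
  ...     | refl = inj₂ (inj₁ (cong (i ,_) (height-injective i P≤2t Q≤2t h≡h′)))

  lab-injective : ∀ i j {P Q} → P ≤ 2 * t i → Q ≤ 2 * t j → lab i P ≡ lab j Q → (i , P) ≡ (j , Q)
  lab-injective i j P≤2t Q≤2t eq with ≺-trichotomy i j P≤2t Q≤2t
  ... | inj₁ i≺j        = contradiction eq (<⇒≢ (lab-< Q≤2t i≺j))
  ... | inj₂ (inj₁ i≡j) = i≡j
  ... | inj₂ (inj₂ j≺i) = contradiction (sym eq) (<⇒≢ (lab-< P≤2t j≺i))

  lab-pos : ∀ i {P} → P ≤ 2 * t i → 0 < lab i P
  lab-pos i P≤2t = <-≤-trans
    (clamp-pos (base i) (2 * t i + 1) (proj₁ (key-self-in-window i P≤2t)) (m≤n+m 1 (2 * t i)))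
    (term≤∑ _ i)

  lab≤ : ∀ i P → lab i P ≤ ∑[ c < k ] (2 * t c + 1)
  lab≤ i P = ∑-mono-≤ (λ c → clamp≤ (base c) (2 * t c + 1) (key c i P))

  near-heights : ∀ i {P Q} → CyclicSucc (2 * t i + 1) P Q → NearDouble (height i P + height i Q) B
  near-heights i adj = subst₂ NearDouble (sym (+-double-interchange (base i) _ _)) (base+t i)
    (NearDouble-shift (base i) (zigzag-near (t i) adj))

  orient-flip : ∀ b₁ b₂ {c i} → b₁ ≢ b₂ → c ≢ i →
                bit (orient b₁ c Fin.≤? orient b₁ i) + bit (orient b₂ c Fin.≤? orient b₂ i) ≡ 1
  orient-flip false false b₁≢b₂ _ = contradiction refl b₁≢b₂
  orient-flip true  true  b₁≢b₂ _ = contradiction refl b₁≢b₂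
  orient-flip false true  _ c≢i   = ≤-vs-opposite c≢i
  orient-flip true  false {c} {i} _ c≢i =
    trans (+-comm (bit (opposite c Fin.≤? opposite i)) (bit (c Fin.≤? i))) (≤-vs-opposite c≢i)

  tie-flip : ∀ h₁ h₂ c i → odd h₁ ≢ odd h₂ → tie h₁ c i + tie h₂ c i ≡ 1 + bit (c Fin.≟ i)
  tie-flip h₁ h₂ c i parities with c Fin.≟ i
  ... | yes refl = cong₂ _+_ (tie-self h₁ c) (tie-self h₂ c)
  ... | no  c≢i  = orient-flip (odd h₁) (odd h₂) parities c≢i

  own≤tie : ∀ h c i → bit (c Fin.≟ i) ≤ tie h c i
  own≤tie h c i = bit-mono (λ { refl → Fin.≤-refl }) _ _

  module _ (c i : Fin k) (P Q : ℕ) where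
    private
      h₁ = height i P
      h₂ = height i Q
      τ₁ = tie h₁ c i
      τ₂ = tie h₂ c i
      δ  = bit (c Fin.≟ i)

      keys≡ : key c i P + key c i Q ≡ (h₁ + h₂) + (τ₁ + τ₂)
      keys≡ = interchange +-commutativeSemigroup h₁ τ₁ h₂ τ₂

      flip : odd (h₁ + h₂) ≡ true → τ₁ + τ₂ ≡ 1 + δ
      flip odd[s] = tie-flip h₁ h₂ c i (odd-sum⇒parities-differ h₁ h₂ odd[s])

    excess : NearDouble (h₁ + h₂) B → ∃ λ σ → key c i P + key c i Q ≡ 2 * B + σ × δ ≤ σ × σ ≤ 2 + δ
    excess (exact s≡) = τ₁ + τ₂ , trans keys≡ (cong (_+ (τ₁ + τ₂)) s≡) ,
      ≤-trans (own≤tie h₁ c i) (m≤m+n τ₁ τ₂) ,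
      ≤-trans (+-mono-≤ (tie≤1 h₁ c i) (tie≤1 h₂ c i)) (m≤m+n 2 δ)
    excess (short s≡) = δ , keys≡2B+δ , ≤-refl , m≤n+m δ 2
      where
      open ≡-Reasoning
      keys≡2B+δ : key c i P + key c i Q ≡ 2 * B + δ
      keys≡2B+δ = begin
        key c i P + key c i Q   ≡⟨ keys≡ ⟩
        (h₁ + h₂) + (τ₁ + τ₂)   ≡⟨ cong ((h₁ + h₂) +_) (flip (odd-if-short {B = B} s≡)) ⟩
        (h₁ + h₂) + (1 + δ)     ≡⟨ +-assoc (h₁ + h₂) 1 δ ⟨
        (h₁ + h₂ + 1) + δ       ≡⟨ cong (_+ δ) s≡ ⟩
        2 * B + δ               ∎
    excess (over s≡) = 2 + δ , keys≡2B+2+δ , m≤n+m δ 2 , ≤-refl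
      where
      open ≡-Reasoning
      keys≡2B+2+δ : key c i P + key c i Q ≡ 2 * B + (2 + δ)
      keys≡2B+2+δ = begin
        key c i P + key c i Q   ≡⟨ keys≡ ⟩
        (h₁ + h₂) + (τ₁ + τ₂)   ≡⟨ cong₂ _+_ s≡ (flip (odd-if-over {B = B} s≡)) ⟩
        (2 * B + 1) + (1 + δ)   ≡⟨ +-assoc (2 * B) 1 (1 + δ) ⟩
        2 * B + (2 + δ)         ∎

  column-pair : ∀ {i P Q} → NearDouble (height i P + height i Q) B → ∀ c →
                2 * t c + bit (c Fin.≟ i) ≤ count c i P + count c i Q ×
                count c i P + count c i Q ≤ 2 * t c + (2 + bit (c Fin.≟ i))
  column-pair {i} {P} {Q} near c with excess c i P Q near
  ... | σ , keys≡ , δ≤σ , σ≤2+δ = window-pair (base c) (t c) (trans keys≡ split) (bit≤1 _) δ≤σ σ≤2+δ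
    where
    split : 2 * B + σ ≡ 2 * base c + (2 * t c + σ)
    split = trans (cong (λ b → 2 * b + σ) (sym (base+t c)))
                  (trans (cong (_+ σ) (*-distribˡ-+ 2 (base c) (t c))) (+-assoc (2 * base c) (2 * t c) σ))

  S : ℕ
  S = ∑[ c < k ] (2 * t c)

  lab-pair : ∀ i {P Q} → CyclicSucc (2 * t i + 1) P Q →
             S + 1 ≤ lab i P + lab i Q × lab i P + lab i Q ≤ S + 1 + 2 * k
  lab-pair i {P} {Q} adj = lower , upper
    where
    open ≤-Reasoning
    δ : Fin k → ℕ
    δ c = bit (c Fin.≟ i)
    reorder : ∀ a b → a + (b * 2 + 1) ≡ a + 1 + 2 * b
    reorder = solve-∀
    bounds : ∀ c → 2 * t c + δ c ≤ count c i P + count c i Q × count c i P + count c i Q ≤ 2 * t c + (2 + δ c)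
    bounds = column-pair {i} {P} {Q} (near-heights i adj)
    lower : S + 1 ≤ lab i P + lab i Q
    lower = begin
      S + 1                                  ≡⟨ cong (S +_) (∑-indicator i) ⟨
      S + ∑[ c < k ] δ c                     ≡⟨ ∑-distrib-+ (λ c → 2 * t c) δ ⟨
      ∑[ c < k ] (2 * t c + δ c)             ≤⟨ ∑-mono-≤ (proj₁ ∘ bounds) ⟩
      ∑[ c < k ] (count c i P + count c i Q) ≡⟨ ∑-distrib-+ (λ c → count c i P) (λ c → count c i Q) ⟩
      lab i P + lab i Q                      ∎
    upper : lab i P + lab i Q ≤ S + 1 + 2 * k
    upper = begin
      lab i P + lab i Q                      ≡⟨ ∑-distrib-+ (λ c → count c i P) (λ c → count c i Q) ⟨
      ∑[ c < k ] (count c i P + count c i Q) ≤⟨ ∑-mono-≤ (proj₂ ∘ bounds) ⟩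
      ∑[ c < k ] (2 * t c + (2 + δ c))       ≡⟨ ∑-distrib-+ (λ c → 2 * t c) (λ c → 2 + δ c) ⟩
      S + ∑[ c < k ] (2 + δ c)               ≡⟨ cong (S +_) (∑-distrib-+ (λ _ → 2) δ) ⟩
      S + (∑[ c < k ] 2 + ∑[ c < k ] δ c)    ≡⟨ cong₂ (λ a b → S + (a + b)) (∑-const k 2) (∑-indicator i) ⟩
      S + (k * 2 + 1)                        ≡⟨ reorder S k ⟩
      S + 1 + 2 * k                          ∎

_∈ₚ_ : ∀ {n} → Fin n → Fin n × Fin n → Set
v ∈ₚ p = proj₁ p ≡ v ⊎ proj₂ p ≡ v

∈ₚ-resp-≈ₚ : ∀ {n} {p q : Fin n × Fin n} {v} → p ≈ₚ q → v ∈ₚ p → v ∈ₚ q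
∈ₚ-resp-≈ₚ (inj₁ (refl , refl)) v∈p        = v∈p
∈ₚ-resp-≈ₚ (inj₂ (refl , refl)) (inj₁ a≡v) = inj₂ a≡v
∈ₚ-resp-≈ₚ (inj₂ (refl , refl)) (inj₂ b≡v) = inj₁ b≡v

≈ₚ-sym : ∀ {n} {p q : Fin n × Fin n} → p ≈ₚ q → q ≈ₚ p
≈ₚ-sym (inj₁ (refl , refl)) = inj₁ (refl , refl)
≈ₚ-sym (inj₂ (refl , refl)) = inj₂ (refl , refl)

Incident : ∀ {n m} → Graph n m → Fin n → Fin m → Set
Incident G v e = v ∈ₚ ends G e

module _ {n m} (G : Graph n m) (f : Labeling m) where

  contrib-incident : ∀ {v e} → Incident G v e → contrib G f v e ≡ label f e
  contrib-incident {v} {e} inc with proj₁ (ends G e) Fin.≟ v | proj₂ (ends G e) Fin.≟ v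
  ... | yes _ | _     = refl
  ... | no _  | yes _ = refl
  ... | no ¬a | no ¬b = contradiction inc [ ¬a , ¬b ]′

  contrib-nonincident : ∀ {v e} → ¬ Incident G v e → contrib G f v e ≡ 0
  contrib-nonincident {v} {e} ¬inc with proj₁ (ends G e) Fin.≟ v | proj₂ (ends G e) Fin.≟ v
  ... | yes a | _     = contradiction (inj₁ a) ¬inc
  ... | no _  | yes b = contradiction (inj₂ b) ¬inc
  ... | no _  | no _  = refl

  vertexSum-two : ∀ {v e₁ e₂} → e₁ ≢ e₂ → Incident G v e₁ → Incident G v e₂ →
                  (∀ e → Incident G v e → e ≡ e₁ ⊎ e ≡ e₂) → vertexSum G f v ≡ label f e₁ + label f e₂
  vertexSum-two {v} {e₁} {e₂} e₁≢e₂ inc₁ inc₂ only = begin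
    vertexSum G f v                     ≡⟨ sum-map-allFin (contrib G f v) ⟩
    sum (contrib G f v)                 ≡⟨ ∑-support₂ e₁ e₂ e₁≢e₂ elsewhere ⟩
    contrib G f v e₁ + contrib G f v e₂ ≡⟨ cong₂ _+_ (contrib-incident inc₁) (contrib-incident inc₂) ⟩
    label f e₁ + label f e₂             ∎
    where
    open ≡-Reasoning
    elsewhere : ∀ e → e ≢ e₁ → e ≢ e₂ → contrib G f v e ≡ 0
    elsewhere e e≢e₁ e≢e₂ = contrib-nonincident λ inc → [ e≢e₁ , e≢e₂ ]′ (only e inc)

labeling-from : ∀ {m} (g : Fin m → ℕ) → Injective _≡_ _≡_ g → (∀ e → 0 < g e) → (∀ e → g e ≤ m) →
                Σ (Labeling m) λ f → ∀ e → label f e ≡ g e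
labeling-from {m} g g-inj g>0 g≤m =
  mk⤖ (to-inj , strictlySurjective⇒surjective (injective⇒surjective to-inj)) , label≡
  where
  suc-pred-g : ∀ e → suc (pred (g e)) ≡ g e
  suc-pred-g e = suc-pred (g e) {{>-nonZero (g>0 e)}}
  to : Fin m → Fin m
  to e = Fin.fromℕ< (subst (_≤ m) (sym (suc-pred-g e)) (g≤m e))
  label≡ : ∀ e → suc (toℕ (to e)) ≡ g e
  label≡ e = trans (cong suc (Fin.toℕ-fromℕ< _)) (suc-pred-g e)
  to-inj : Injective _≡_ _≡_ to
  to-inj {a} {b} eq = g-inj (trans (sym (label≡ a)) (trans (cong (suc ∘ toℕ) eq) (label≡ b)))

window⇒approxMagic : ∀ {n m} (G : Graph n m) (f : Labeling m) {lo w δ} → w ≤ δ →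
                     (∀ v → lo ≤ vertexSum G f v × vertexSum G f v ≤ lo + w) → ApproxMagicLabeling G δ f
window⇒approxMagic G f {lo} {w} {δ} w≤δ window u v = begin
  vertexSum G f u     ≤⟨ proj₂ (window u) ⟩
  lo + w              ≤⟨ +-mono-≤ (proj₁ (window v)) w≤δ ⟩
  vertexSum G f v + δ ∎
  where open ≤-Reasoning

-- Unions of odd cycles

module _ {n m} {G : Graph n m} (C : OddCycleUnion G) where
  open OddCycleUnion C
  private
    module Φ = Inverse (⤖⇒↔ φ)
    module Ψ = Inverse (⤖⇒↔ ψ)

  Pos : Set
  Pos = Σ (Fin k) (Fin ∘ len)

  succ : Pos → Pos
  succ x = proj₁ x , next (proj₂ x)

  succ-injective : Injective _≡_ _≡_ succ
  succ-injective {i , j} eq with Σ-≡,≡←≡ eq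
  ... | refl , next-j≡ = cong (i ,_) (next-injective next-j≡)

  succ≢ : ∀ x → succ x ≢ x
  succ≢ (i , j) eq with Σ-≡,≡←≡ eq
  ... | refl , next-j≡j = next≢ (≤-trans (s≤s (s≤s z≤n)) (len≥3 i)) j next-j≡j

  prev : Pos → Pos
  prev (i , j) = i , proj₁ (next-surjective j)

  succ-prev : ∀ x → succ (prev x) ≡ x
  succ-prev (i , j) = cong (i ,_) (proj₂ (next-surjective j))

  Ψ-from-injective : Injective _≡_ _≡_ Ψ.from
  Ψ-from-injective {x} {y} eq = trans (sym (Ψ.strictlyInverseˡ x)) (trans (cong Ψ.to eq) (Ψ.strictlyInverseˡ y))

  incident-edges : ∀ {e y} → Incident G (Φ.to y) e → Ψ.to e ≡ y ⊎ succ (Ψ.to e) ≡ y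
  incident-edges {e} inc with ∈ₚ-resp-≈ₚ (edges e) inc
  ... | inj₁ φx≡φy  = inj₁ (Bijection.injective φ φx≡φy)
  ... | inj₂ φx⁺≡φy = inj₂ (Bijection.injective φ φx⁺≡φy)

  edge-incident : ∀ x → Incident G (Φ.to x) (Ψ.from x) × Incident G (Φ.to (succ x)) (Ψ.from x)
  edge-incident x =
    subst (λ y → Incident G (Φ.to y) (Ψ.from x)) (Ψ.strictlyInverseˡ x)
      (∈ₚ-resp-≈ₚ (≈ₚ-sym (edges (Ψ.from x))) (inj₁ refl)) ,
    subst (λ y → Incident G (Φ.to (succ y)) (Ψ.from x)) (Ψ.strictlyInverseˡ x)
      (∈ₚ-resp-≈ₚ (≈ₚ-sym (edges (Ψ.from x))) (inj₂ refl))

  vertexSum-succ : ∀ f x → vertexSum G f (Φ.to (succ x)) ≡ label f (Ψ.from x) + label f (Ψ.from (succ x))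
  vertexSum-succ f x = vertexSum-two G f (λ eq → succ≢ x (sym (Ψ-from-injective eq)))
    (proj₂ (edge-incident x)) (proj₁ (edge-incident (succ x))) only
    where
    only : ∀ e → Incident G (Φ.to (succ x)) e → e ≡ Ψ.from x ⊎ e ≡ Ψ.from (succ x)
    only e inc with incident-edges inc
    ... | inj₁ e↦x⁺ = inj₂ (trans (sym (Ψ.strictlyInverseʳ e)) (cong Ψ.from e↦x⁺))
    ... | inj₂ e↦x  = inj₁ (trans (sym (Ψ.strictlyInverseʳ e)) (cong Ψ.from (succ-injective e↦x)))

  t : Fin k → ℕ
  t i = proj₁ (lenOdd i)

  len≡ : ∀ i → len i ≡ 2 * t i + 1
  len≡ i = proj₂ (lenOdd i)

  open RankLabeling t using (lab; lab-injective; lab-pos; lab≤; lab-pair; S)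

  toℕ≤2t : ∀ i (j : Fin (len i)) → toℕ j ≤ 2 * t i
  toℕ≤2t i j = s≤s⁻¹ (subst (toℕ j <_) (trans (len≡ i) (+-comm (2 * t i) 1)) (Fin.toℕ<n j))

  rank : Pos → ℕ
  rank (i , j) = lab i (toℕ j)

  rank-injective : Injective _≡_ _≡_ rank
  rank-injective {i , j} {i′ , j′} eq
    with ,-injective (lab-injective i i′ (toℕ≤2t i j) (toℕ≤2t i′ j′) eq)
  ... | refl , toℕj≡ = cong (i ,_) (Fin.toℕ-injective toℕj≡)

  rank-pos : ∀ x → 0 < rank x
  rank-pos (i , j) = lab-pos i (toℕ≤2t i j)

  rank≤m : ∀ x → rank x ≤ m
  rank≤m (i , j) = begin
    lab i (toℕ j)            ≤⟨ lab≤ i (toℕ j) ⟩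
    ∑[ c < k ] (2 * t c + 1) ≡⟨ sum-cong-≗ (sym ∘ len≡) ⟩
    sum len                  ≤⟨ injective⇒∑≤ Ψ-from-injective ⟩
    m                        ∎
    where open ≤-Reasoning

  rank-pair : ∀ x → S + 1 ≤ rank x + rank (succ x) × rank x + rank (succ x) ≤ S + 1 + 2 * k
  rank-pair (i , j) = lab-pair i (subst (λ ℓ → CyclicSucc ℓ (toℕ j) (toℕ (next j))) (len≡ i) (toℕ-next j))

  rank-labeling : Σ (Labeling m) λ f → ∀ v → S + 1 ≤ vertexSum G f v × vertexSum G f v ≤ S + 1 + 2 * k
  rank-labeling = f , window
    where
    labeled : Σ (Labeling m) λ f → ∀ e → label f e ≡ rank (Ψ.to e)
    labeled = labeling-from (rank ∘ Ψ.to) (Bijection.injective ψ ∘ rank-injective)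
                            (rank-pos ∘ Ψ.to) (rank≤m ∘ Ψ.to)
    f : Labeling m
    f = proj₁ labeled
    label≡rank : ∀ x → label f (Ψ.from x) ≡ rank x
    label≡rank x = trans (proj₂ labeled (Ψ.from x)) (cong rank (Ψ.strictlyInverseˡ x))
    window : ∀ v → S + 1 ≤ vertexSum G f v × vertexSum G f v ≤ S + 1 + 2 * k
    window v = subst (λ s → S + 1 ≤ s × s ≤ S + 1 + 2 * k) (sym vs≡) (rank-pair x)
      where
      x = prev (Φ.from v)
      open ≡-Reasoning
      vs≡ : vertexSum G f v ≡ rank x + rank (succ x)
      vs≡ = begin
        vertexSum G f v                                ≡⟨ cong (vertexSum G f) (trans (sym (Φ.strictlyInverseˡ v))
                                                                 (cong Φ.to (sym (succ-prev (Φ.from v))))) ⟩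
        vertexSum G f (Φ.to (succ x))                  ≡⟨ vertexSum-succ f x ⟩
        label f (Ψ.from x) + label f (Ψ.from (succ x)) ≡⟨ cong₂ _+_ (label≡rank x) (label≡rank (succ x)) ⟩
        rank x + rank (succ x)                         ∎

  k*3≤n : k * 3 ≤ n
  k*3≤n = begin
    k * 3        ≡⟨ ∑-const k 3 ⟨
    ∑[ i < k ] 3 ≤⟨ ∑-mono-≤ len≥3 ⟩
    sum len      ≤⟨ injective⇒∑≤ (Bijection.injective φ) ⟩
    n            ∎
    where open ≤-Reasoning

2k≤⌈2n/3⌉ : ∀ k {n} → k * 3 ≤ n → 2 * k ≤ ceil2n/3 n
2k≤⌈2n/3⌉ k {n} k*3≤n = begin
  2 * k           ≡⟨ m*n/n≡m (2 * k) 3 ⟨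
  2 * k * 3 / 3   ≤⟨ /-monoˡ-≤ 3 (begin
    2 * k * 3       ≡⟨ *-assoc 2 k 3 ⟩
    2 * (k * 3)     ≤⟨ *-monoʳ-≤ 2 k*3≤n ⟩
    2 * n           ≤⟨ m≤m+n (2 * n) 2 ⟩
    2 * n + 2       ∎) ⟩
  (2 * n + 2) / 3 ∎
  where open ≤-Reasoning

lemma5p1 : (n m : ℕ) → 3 ≤ n → (G : Graph n m) → OddCycleUnion G →
    ApproxMagic G (ceil2n/3 n)
lemma5p1 n m _ G C =
  let f , window = rank-labeling C
  in  f , window⇒approxMagic G f (2k≤⌈2n/3⌉ (OddCycleUnion.k C) (k*3≤n C)) window
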